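{- Let $q$ be an odd prime power, $t\ge3$, $n=2t$, and $W=\{x\in\mathbb{F}_{q^{2t}} : x^{q^t}+x=0\}$. (i) There are precisely $(q^t-1)/(q-1)$ elements of $\mathbb{F}_{q^t}^*$ which are $(q-1)$-th powers of elements of $W$; namely, they are the solutions of $x^{\frac{q^t-1}{q-1}}=-1$, $x\in\mathbb{F}_{q^n}$. (ii) If $t$ is even, there are precisely $(q^t-1)/(q+1)$ elements of $\mathbb{F}_{q^t}^*$ which are $(q+1)$-th powers of elements of $W$; namely, they are the solutions of $x^{\frac{q^t-1}{q+1}}=-1$, $x\in\mathbb{F}_{q^n}$. (iii) If $t$ is odd, there are precisely $(q^t-1)/2$ elements of $\mathbb{F}_{q^t}^*$ which are $(q+1)$-th powers of elements of $W$; namely, they are the solutions of $x^{\frac{q^t-1}{2}}=(-1)^{\frac{q+1}{2}}$, $x\in\mathbb{F}_{q^n}$. -}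

module Defs where

import Level
open import Data.Nat using (ℕ; zero; suc; _≤_; _∸_)
open import Data.Nat.DivMod using (_/_)
open import Data.Nat.Primality using (Prime)
open import Data.Fin using (Fin)
open import Data.List using (List; length; filter; allFin)
open import Data.Product using (Σ; ∃; _×_)
open import Relation.Nullary using (¬_)
open import Relation.Unary using (Pred; Decidable)
open import Relation.Binary.PropositionalEquality using (_≡_; _≢_)
open import Relation.Binary.Definitions using (DecidableEquality)
open import Algebra.Core using (Op₁; Op₂)
open import Algebra.Structures using (IsCommutativeRing)
open import Function.Bundles using (_↔_; Inverse)

IsPrimePower : ℕ → Set
IsPrimePower q = Σ ℕ λ p → Σ ℕ λ k → Prime p × 1 ≤ k × q ≡ p Data.Nat.^ k

-- Natural-number division, with the (never used here) convention m / 0 = 0.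
div : ℕ → ℕ → ℕ
div m zero = 0
div m (suc n) = m / suc n

-- A finite field: a commutative ring (with propositional equality) in which
-- 0 ≠ 1 and every nonzero element is invertible, with decidable equality and
-- an explicit bijection with Fin size (so 'size' is its number of elements).
record FiniteField : Set₁ where
  infixl 6 _+_
  infixl 7 _*_
  infix 4 _≟_
  field
    Carrier : Set
    _+_ _*_ : Op₂ Carrier
    -_ : Op₁ Carrier
    0# 1# : Carrier
    isCommutativeRing : IsCommutativeRing _≡_ _+_ _*_ -_ 0# 1#
    0≢1 : 0# ≢ 1#
    inverse : ∀ x → x ≢ 0# → ∃ λ y → x * y ≡ 1#
    _≟_ : DecidableEquality Carrier
    size : ℕ
    enum : Carrier ↔ Fin size

  infixr 8 _^ᶠ_
  _^ᶠ_ : Carrier → ℕ → Carrier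
  x ^ᶠ zero = 1#
  x ^ᶠ suc n = x * (x ^ᶠ n)

  -- W = { x : x^(q^t) + x = 0 }, with Q = q^t
  InW : ℕ → Carrier → Set
  InW Q w = w ^ᶠ Q + w ≡ 0#

  -- x ∈ F_{q^t}^* (the subfield of order Q = q^t, without 0)
  InSubStar : ℕ → Carrier → Set
  InSubStar Q x = (x ^ᶠ Q ≡ x) × (x ≢ 0#)

  PowOfW : ℕ → ℕ → Carrier → Set
  PowOfW Q m x = ∃ λ w → InW Q w × w ^ᶠ m ≡ x

  count : {P : Pred Carrier Level.zero} → Decidable P → ℕ
  count P? = length (filter (λ i → P? (Inverse.from enum i)) (allFin size))

-- Write Q = qᵗ and A = Q - 1, so F has A (A + 2) units. From Lagrange's theorem, the bound on the number of roots
-- of xⁿ = b and fibre counting (no cyclicity of F* is needed), xᵈ = ±1 has exactly d solutions whenever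
-- 2d ∣ A (A + 2). The nonzero elements of W are the A solutions of wᴬ = -1; w ↦ wˢ maps them into the D solutions
-- of xᴰ = ε with fibres of size at most k, where k D = A, so it misses no point. Finally xᴰ = ±1 with 2D ∣ A
-- gives xᴬ = 1, i.e. x ∈ F_Q*.

module Submission where

open import Defs
open import Level using (0ℓ)
open import Data.Nat as ℕ using (ℕ; zero; suc; _^_; _≤_; _<_; z≤n; s≤s; NonZero; nonTrivial⇒n>1; _∸_)
import Data.Nat.Properties as ℕ
open import Data.Nat.Primality using (prime⇒nonZero; prime⇒nonTrivial)
open import Data.Nat.Tactic.RingSolver using (solve-∀)
open import Data.Nat.Divisibility using (_∣_; divides; quotient≢0)
import Data.Nat.Divisibility as ℕ
open import Data.Nat.DivMod using (m/n*n≡m)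
open import Data.List using (List; []; _∷_; length; replicate; filter; map; allFin; foldr)
open import Data.List.Properties using (length-tabulate; length-replicate; length-map; filter-notAll)
open import Data.List.Relation.Unary.All as All using (All; []; _∷_)
import Data.List.Relation.Unary.All.Properties as All
open import Data.List.Relation.Unary.Any as Any using (here; there; any?)
open import Data.List.Relation.Unary.AllPairs using ([]; _∷_)
open import Data.List.Relation.Unary.Unique.Propositional using (Unique)
import Data.List.Relation.Unary.Unique.Propositional.Properties as Unique
open import Data.List.Membership.Propositional using (_∈_; find; lose)
open import Data.List.Relation.Binary.Subset.Propositional using (_⊆_)
open import Data.List.Relation.Binary.Permutation.Propositional using (_↭_; ↭⇒↭ₛ)
open import Data.List.Relation.Binary.BagAndSetEquality using (∼bag⇒↭)
open import Data.List.Membership.Propositional.Properties.WithK using (unique∧set⇒bag)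
open import Data.List.Membership.Propositional.Properties using (∈-map⁺; ∈-map⁻; ∈-allFin; ∈-filter⁺)
open import Data.Sum using (_⊎_; inj₁; inj₂)
open import Data.Product using (_,_; proj₁; proj₂; _×_; ∃)
open import Relation.Nullary using (¬_; yes; no; ¬?; contradiction)
open import Relation.Nullary.Decidable using (decidable-stable)
open import Relation.Unary using (Pred; Decidable)
open import Relation.Binary.Definitions using (DecidableEquality)
open import Relation.Unary.Properties using (_∩?_; ∁?)
open import Relation.Binary.PropositionalEquality
open import Algebra.Bundles using (CommutativeRing)
open import Algebra.Structures using (IsCommutativeRing)
open import Function.Base using (id; _∘_)
open import Function.Bundles using (Inverse; _⇔_; mk⇔)
open import Function.Definitions using (Injective)

module _ {A : Set} where

  length-filter+filter∁ : ∀ {P : Pred A 0ℓ} (P? : Decidable P) xs →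
    length (filter P? xs) ℕ.+ length (filter (∁? P?) xs) ≡ length xs
  length-filter+filter∁ P? [] = refl
  length-filter+filter∁ P? (x ∷ xs) with P? x
  ... | yes _ = cong suc (length-filter+filter∁ P? xs)
  ... | no _ = trans (ℕ.+-suc _ _) (cong suc (length-filter+filter∁ P? xs))

  unique-⊆⇒length≤ : DecidableEquality A → ∀ {xs ys} → Unique xs → xs ⊆ ys → length xs ≤ length ys
  unique-⊆⇒length≤ _≟_ {[]} _ _ = z≤n
  unique-⊆⇒length≤ _≟_ {x ∷ xs} {ys} (x∉xs ∷ xs-unique) x∷xs⊆ys = begin
    suc (length xs)                     ≤⟨ s≤s (unique-⊆⇒length≤ _≟_ xs-unique xs⊆ys-x) ⟩
    suc (length (filter ≢x? ys))        ≤⟨ filter-notAll ≢x? ys (Any.map (λ x≡y y≢x → y≢x (sym x≡y)) x∈ys) ⟩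
    length ys                           ∎
    where
    open ℕ.≤-Reasoning
    ≢x? = λ y → ¬? (y ≟ x)
    x∈ys = x∷xs⊆ys (here refl)
    xs⊆ys-x : xs ⊆ filter ≢x? ys
    xs⊆ys-x y∈xs = ∈-filter⁺ ≢x? (x∷xs⊆ys (there y∈xs)) (λ y≡x → All.lookup x∉xs y∈xs (sym y≡x))

  length≤fibres : ∀ {B : Set} → DecidableEquality B → (f : A → B) {P : Pred A 0ℓ} (k : ℕ) →
    (∀ y {zs} → Unique zs → All (λ x → P x × f x ≡ y) zs → length zs ≤ k) →
    ∀ ys {xs} → Unique xs → All (λ x → P x × f x ∈ ys) xs → length xs ≤ k ℕ.* length ys
  length≤fibres _≟_ f k fibre [] {[]} _ _ = z≤n
  length≤fibres _≟_ f k fibre [] {x ∷ xs} _ ((_ , ()) ∷ _)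
  length≤fibres _≟_ f {P} k fibre (y ∷ ys) {xs} xs-unique xs-into = begin
    length xs                                                    ≡⟨ length-filter+filter∁ over? xs ⟨
    length (filter over? xs) ℕ.+ length (filter (∁? over?) xs)   ≤⟨ ℕ.+-mono-≤ on-y off-y ⟩
    k ℕ.+ k ℕ.* length ys                                          ≡⟨ ℕ.*-suc k (length ys) ⟨
    k ℕ.* suc (length ys)                                          ∎
    where
    open ℕ.≤-Reasoning
    over? = λ x → f x ≟ y
    into-ys : ∀ {x} → (P x × f x ∈ y ∷ ys) × ¬ f x ≡ y → P x × f x ∈ ys
    into-ys ((px , here fx≡y) , fx≢y) = contradiction fx≡y fx≢y
    into-ys ((px , there fx∈ys) , _) = px , fx∈ys
    on-y = fibre y (Unique.filter⁺ over? xs-unique)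
      (All.zipWith (λ ((px , _) , fx≡y) → px , fx≡y) (All.filter⁺ over? xs-into , All.all-filter over? xs))
    off-y = length≤fibres _≟_ f k fibre ys (Unique.filter⁺ (∁? over?) xs-unique)
      (All.zipWith into-ys (All.filter⁺ (∁? over?) xs-into , All.all-filter (∁? over?) xs))

div*n≡m : ∀ {m} n .{{_ : NonZero n}} → n ∣ m → div m n ℕ.* n ≡ m
div*n≡m (suc n) n∣m = m/n*n≡m n∣m

parity : ∀ n → 2 ∣ n ⊎ 2 ∣ suc n
parity zero = inj₁ (2 ℕ.∣0)
parity (suc n) with parity n
... | inj₁ 2∣n = inj₂ (ℕ.∣m∣n⇒∣m+n ℕ.∣-refl 2∣n)
... | inj₂ 2∣1+n = inj₁ 2∣1+n

odd⇒2∣m+1 : ∀ {m} → ¬ 2 ∣ m → 2 ∣ m ℕ.+ 1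
odd⇒2∣m+1 {m} 2∤m with parity m
... | inj₁ 2∣m = contradiction 2∣m 2∤m
... | inj₂ 2∣1+m = subst (2 ∣_) (ℕ.+-comm 1 m) 2∣1+m

odd⇒2∣m∸1 : ∀ {m} → ¬ 2 ∣ m → 2 ∣ m ∸ 1
odd⇒2∣m∸1 {zero} 2∤0 = contradiction (2 ℕ.∣0) 2∤0
odd⇒2∣m∸1 {suc m} 2∤1+m with parity m
... | inj₁ 2∣m = 2∣m
... | inj₂ 2∣1+m = contradiction 2∣1+m 2∤1+m

prime-power⇒1< : ∀ {q} → IsPrimePower q → 1 < q
prime-power⇒1< (p , k , p-prime , 1≤k , refl) =
  ℕ.≤-trans (nonTrivial⇒n>1 p {{prime⇒nonTrivial p-prime}})
    (subst (_≤ p ^ k) (ℕ.^-identityʳ p) (ℕ.^-monoʳ-≤ p {{prime⇒nonZero p-prime}} 1≤k))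

m*n∸1≡m*[n∸1]+[m∸1] : ∀ m n .{{_ : NonZero m}} .{{_ : NonZero n}} → m ℕ.* n ∸ 1 ≡ m ℕ.* (n ∸ 1) ℕ.+ (m ∸ 1)
m*n∸1≡m*[n∸1]+[m∸1] (suc m) (suc n) = identity m n
  where
  identity : ∀ m n → n ℕ.+ m ℕ.* suc n ≡ suc m ℕ.* n ℕ.+ m
  identity = solve-∀

m*n+1≡m*[n∸1]+[m+1] : ∀ m n .{{_ : NonZero n}} → m ℕ.* n ℕ.+ 1 ≡ m ℕ.* (n ∸ 1) ℕ.+ (m ℕ.+ 1)
m*n+1≡m*[n∸1]+[m+1] m (suc n) = identity m n
  where
  identity : ∀ m n → m ℕ.* suc n ℕ.+ 1 ≡ m ℕ.* n ℕ.+ (m ℕ.+ 1)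
  identity = solve-∀

∣m∸1⇒∣m^n∸1 : ∀ {d} m n .{{_ : NonZero m}} → d ∣ m ∸ 1 → d ∣ m ^ n ∸ 1
∣m∸1⇒∣m^n∸1 m zero _ = _ ℕ.∣0
∣m∸1⇒∣m^n∸1 {d} m (suc n) d∣m∸1 = subst (d ∣_) (sym (m*n∸1≡m*[n∸1]+[m∸1] m (m ^ n)))
  (ℕ.∣m∣n⇒∣m+n (ℕ.∣n⇒∣m*n m (∣m∸1⇒∣m^n∸1 m n d∣m∸1)) d∣m∸1)
  where
  instance
    mⁿ≢0 : NonZero (m ^ n)
    mⁿ≢0 = ℕ.m^n≢0 m n

m+1∣m^2∸1 : ∀ m → m ℕ.+ 1 ∣ m ^ 2 ∸ 1
m+1∣m^2∸1 zero = 1 ℕ.∣0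
m+1∣m^2∸1 (suc m) = divides m (identity m)
  where
  identity : ∀ m → m ℕ.* 1 ℕ.+ m ℕ.* suc (m ℕ.* 1) ≡ m ℕ.* (suc m ℕ.+ 1)
  identity = solve-∀

even⇒m+1∣m^t∸1 : ∀ m {t} .{{_ : NonZero m}} → 2 ∣ t → m ℕ.+ 1 ∣ m ^ t ∸ 1
even⇒m+1∣m^t∸1 m (divides c t≡c*2) =
  subst (λ n → m ℕ.+ 1 ∣ n ∸ 1) (trans (ℕ.^-*-assoc m 2 c) (cong (m ^_) (trans (ℕ.*-comm 2 c) (sym t≡c*2))))
    (∣m∸1⇒∣m^n∸1 (m ^ 2) c {{ℕ.m^n≢0 m 2}} (m+1∣m^2∸1 m))

odd⇒m+1∣m^t+1 : ∀ m {t} .{{_ : NonZero m}} → ¬ 2 ∣ t → m ℕ.+ 1 ∣ m ^ t ℕ.+ 1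
odd⇒m+1∣m^t+1 m {zero} 2∤0 = contradiction (2 ℕ.∣0) 2∤0
odd⇒m+1∣m^t+1 m {suc t} 2∤1+t with parity t
... | inj₂ 2∣1+t = contradiction 2∣1+t 2∤1+t
... | inj₁ 2∣t = subst (m ℕ.+ 1 ∣_) (sym (m*n+1≡m*[n∸1]+[m+1] m (m ^ t) {{ℕ.m^n≢0 m t}}))
  (ℕ.∣m∣n⇒∣m+n (ℕ.∣n⇒∣m*n m (even⇒m+1∣m^t∸1 m 2∣t)) ℕ.∣-refl)

module _ (F : FiniteField) where
  open FiniteField F
  open IsCommutativeRing isCommutativeRing
    using (*-isCommutativeMonoid; *-comm; *-assoc; *-identityˡ; *-identityʳ; zeroˡ; zeroʳ; distribˡ;
           +-identityˡ; +-identityʳ; -‿inverseˡ; -‿inverseʳ)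

  commutativeRing : CommutativeRing 0ℓ 0ℓ
  commutativeRing = record { isCommutativeRing = isCommutativeRing }

  open CommutativeRing commutativeRing using (ring; semiring; commutativeSemiring)
  open import Algebra.Properties.Ring ring using (-‿involutive; +-inverseˡ-unique; -1*x≈-x; -0#≈0#)
  open import Algebra.Properties.Semiring.Exp semiring using (^-homo-*; ^-assocʳ) renaming (_^_ to _^ˢ_)
  open import Algebra.Properties.CommutativeSemiring.Exp commutativeSemiring using (^-distrib-*)
  open import Algebra.Solver.Ring.NaturalCoefficients.Default commutativeSemiring
  open import Data.List.Relation.Binary.Permutation.Setoid.Properties (setoid Carrier) using (foldr-commMonoid)

  x*y≡0⇒x≡0⊎y≡0 : ∀ x y → x * y ≡ 0# → x ≡ 0# ⊎ y ≡ 0#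
  x*y≡0⇒x≡0⊎y≡0 x y xy≡0 with x ≟ 0#
  ... | yes x≡0 = inj₁ x≡0
  ... | no x≢0 with inverse x x≢0
  ... | x⁻¹ , xx⁻¹≡1 = inj₂ (begin
    y               ≡⟨ sym (*-identityˡ y) ⟩
    1# * y          ≡⟨ cong (_* y) (trans (sym xx⁻¹≡1) (*-comm x x⁻¹)) ⟩
    (x⁻¹ * x) * y   ≡⟨ *-assoc x⁻¹ x y ⟩
    x⁻¹ * (x * y)   ≡⟨ cong (x⁻¹ *_) xy≡0 ⟩
    x⁻¹ * 0#        ≡⟨ zeroʳ x⁻¹ ⟩
    0#              ∎)
    where open ≡-Reasoning

  *-≢0 : ∀ {x y} → x ≢ 0# → y ≢ 0# → x * y ≢ 0#
  *-≢0 {x} {y} x≢0 y≢0 xy≡0 with x*y≡0⇒x≡0⊎y≡0 x y xy≡0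
  ... | inj₁ x≡0 = x≢0 x≡0
  ... | inj₂ y≡0 = y≢0 y≡0

  x-y≡0⇒x≡y : ∀ {x y} → x + - y ≡ 0# → x ≡ y
  x-y≡0⇒x≡y {x} {y} x-y≡0 = trans (+-inverseˡ-unique x (- y) x-y≡0) (-‿involutive y)

  *-cancelˡ : ∀ {x a b} → x ≢ 0# → x * a ≡ x * b → a ≡ b
  *-cancelˡ {x} {a} {b} x≢0 xa≡xb with x*y≡0⇒x≡0⊎y≡0 x (a + - b) x[a-b]≡0
    where
    x[a-b]≡0 : x * (a + - b) ≡ 0#
    x[a-b]≡0 = begin
      x * (a + - b)      ≡⟨ distribˡ x a (- b) ⟩
      x * a + x * - b    ≡⟨ cong (_+ x * - b) xa≡xb ⟩
      x * b + x * - b    ≡⟨ distribˡ x b (- b) ⟨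
      x * (b + - b)      ≡⟨ cong (x *_) (-‿inverseʳ b) ⟩
      x * 0#             ≡⟨ zeroʳ x ⟩
      0#                 ∎
      where open ≡-Reasoning
  ... | inj₁ x≡0 = contradiction x≡0 x≢0
  ... | inj₂ a-b≡0 = x-y≡0⇒x≡y a-b≡0

  -1≢0 : - 1# ≢ 0#
  -1≢0 -1≡0 = 0≢1 (sym (trans (sym (-‿involutive 1#)) (trans (cong -_ -1≡0) -0#≈0#)))

  IsSign : Carrier → Set
  IsSign ε = ε ≡ 1# ⊎ ε ≡ - 1#

  -1*-1≡1 : - 1# * - 1# ≡ 1#
  -1*-1≡1 = trans (-1*x≈-x (- 1#)) (-‿involutive 1#)

  sign*sign≡1 : ∀ {ε} → IsSign ε → ε * ε ≡ 1#
  sign*sign≡1 (inj₁ refl) = *-identityˡ 1#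
  sign*sign≡1 (inj₂ refl) = -1*-1≡1

  sign≢0 : ∀ {ε} → IsSign ε → ε ≢ 0#
  sign≢0 (inj₁ refl) 1≡0 = 0≢1 (sym 1≡0)
  sign≢0 (inj₂ refl) = -1≢0

  x*x≡1⇒sign : ∀ x → x * x ≡ 1# → IsSign x
  x*x≡1⇒sign x xx≡1 with x*y≡0⇒x≡0⊎y≡0 (x + - 1#) (x + 1#) [x-1][x+1]≡0
    where
    [x-1][x+1]≡0 : (x + - 1#) * (x + 1#) ≡ 0#
    [x-1][x+1]≡0 = begin
      (x + - 1#) * (x + 1#)             ≡⟨ solve 2 (λ x n → (x :+ n) :* (x :+ con 1) := x :* x :+ n :+ x :* (n :+ con 1))
                                                     refl x (- 1#) ⟩
      x * x + - 1# + x * (- 1# + 1#)    ≡⟨ cong₂ (λ a b → a + - 1# + x * b) xx≡1 (-‿inverseˡ 1#) ⟩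
      1# + - 1# + x * 0#                ≡⟨ cong₂ _+_ (-‿inverseʳ 1#) (zeroʳ x) ⟩
      0# + 0#                           ≡⟨ +-identityʳ 0# ⟩
      0#                                ∎
      where open ≡-Reasoning
  ... | inj₁ x-1≡0 = inj₁ (x-y≡0⇒x≡y x-1≡0)
  ... | inj₂ x+1≡0 = inj₂ (+-inverseˡ-unique x 1# x+1≡0)

  ^ᶠ≡^ˢ : ∀ x n → x ^ᶠ n ≡ x ^ˢ n
  ^ᶠ≡^ˢ x zero = refl
  ^ᶠ≡^ˢ x (suc n) = cong (x *_) (^ᶠ≡^ˢ x n)

  ^ᶠ-+ : ∀ x m n → x ^ᶠ (m ℕ.+ n) ≡ x ^ᶠ m * x ^ᶠ n
  ^ᶠ-+ x m n rewrite ^ᶠ≡^ˢ x (m ℕ.+ n) | ^ᶠ≡^ˢ x m | ^ᶠ≡^ˢ x n = ^-homo-* x m n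

  ^ᶠ-* : ∀ x m n → x ^ᶠ (m ℕ.* n) ≡ (x ^ᶠ m) ^ᶠ n
  ^ᶠ-* x m n rewrite ^ᶠ≡^ˢ x (m ℕ.* n) | ^ᶠ≡^ˢ (x ^ᶠ m) n | ^ᶠ≡^ˢ x m = sym (^-assocʳ x m n)

  *-^ᶠ : ∀ x y n → (x * y) ^ᶠ n ≡ x ^ᶠ n * y ^ᶠ n
  *-^ᶠ x y n rewrite ^ᶠ≡^ˢ (x * y) n | ^ᶠ≡^ˢ x n | ^ᶠ≡^ˢ y n = ^-distrib-* x y n

  1^ᶠ : ∀ n → 1# ^ᶠ n ≡ 1#
  1^ᶠ zero = refl
  1^ᶠ (suc n) = trans (*-identityˡ _) (1^ᶠ n)

  0^ᶠ : ∀ n .{{_ : NonZero n}} → 0# ^ᶠ n ≡ 0#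
  0^ᶠ (suc n) = zeroˡ _

  -1^ᶠ-sign : ∀ n → IsSign ((- 1#) ^ᶠ n)
  -1^ᶠ-sign zero = inj₁ refl
  -1^ᶠ-sign (suc n) with -1^ᶠ-sign n
  ... | inj₁ ε≡1 = inj₂ (trans (cong (- 1# *_) ε≡1) (*-identityʳ _))
  ... | inj₂ ε≡-1 = inj₁ (trans (cong (- 1# *_) ε≡-1) -1*-1≡1)

  -- c₀ ∷ c₁ ∷ … ∷ cₙ₋₁ stands for c₀ + c₁ x + … + cₙ₋₁ xⁿ⁻¹ + xⁿ.
  evalMonic : List Carrier → Carrier → Carrier
  evalMonic [] x = 1#
  evalMonic (c ∷ cs) x = c + x * evalMonic cs x

  quotientBy : Carrier → List Carrier → List Carrier
  quotientBy a [] = []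
  quotientBy a (c ∷ []) = []
  quotientBy a (c ∷ d ∷ ds) = evalMonic (d ∷ ds) a ∷ quotientBy a (d ∷ ds)

  length-quotientBy : ∀ a c cs → length (quotientBy a (c ∷ cs)) ≡ length cs
  length-quotientBy a c [] = refl
  length-quotientBy a c (d ∷ ds) = cong suc (length-quotientBy a d ds)

  -- The solver has no negation: - a enters as an atom, and this vanishing term supplies the relation - a + a = 0.
  y≡y+[-a+a]*r : ∀ a r y → y ≡ y + (- a + a) * r
  y≡y+[-a+a]*r a r y =
    sym (trans (cong (λ z → y + z * r) (-‿inverseˡ a)) (trans (cong (y +_) (zeroˡ r)) (+-identityʳ y)))

  remainder-theorem : ∀ a x c cs →
    evalMonic (c ∷ cs) x ≡ (x + - a) * evalMonic (quotientBy a (c ∷ cs)) x + evalMonic (c ∷ cs) a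
  remainder-theorem a x c [] = begin
    c + x * 1#                                    ≡⟨ y≡y+[-a+a]*r a 1# _ ⟩
    c + x * 1# + (- a + a) * 1#                   ≡⟨ solve 4 (λ c x na a → c :+ x :* con 1 :+ (na :+ a) :* con 1
                                                                     := (x :+ na) :* con 1 :+ (c :+ a :* con 1))
                                                             refl c x (- a) a ⟩
    (x + - a) * 1# + (c + a * 1#)                 ∎
    where open ≡-Reasoning
  remainder-theorem a x c (d ∷ ds) = begin
    c + x * evalMonic (d ∷ ds) x                  ≡⟨ cong (λ z → c + x * z) (remainder-theorem a x d ds) ⟩
    c + x * ((x + - a) * q + r)                   ≡⟨ y≡y+[-a+a]*r a r _ ⟩
    c + x * ((x + - a) * q + r) + (- a + a) * r   ≡⟨ solve 6 (λ c x a na q r → c :+ x :* ((x :+ na) :* q :+ r) :+ (na :+ a) :* r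
                                                                         := (x :+ na) :* (r :+ x :* q) :+ (c :+ a :* r))
                                                             refl c x a (- a) q r ⟩
    (x + - a) * (r + x * q) + (c + a * r)         ∎
    where
    open ≡-Reasoning
    q = evalMonic (quotientBy a (d ∷ ds)) x
    r = evalMonic (d ∷ ds) a

  root-of-quotientBy : ∀ {a s} c cs → evalMonic (c ∷ cs) a ≡ 0# → evalMonic (c ∷ cs) s ≡ 0# → a ≢ s →
    evalMonic (quotientBy a (c ∷ cs)) s ≡ 0#
  root-of-quotientBy {a} {s} c cs pa≡0 ps≡0 a≢s with x*y≡0⇒x≡0⊎y≡0 (s + - a) qs [s-a]qs≡0
    where
    open ≡-Reasoning
    qs = evalMonic (quotientBy a (c ∷ cs)) s
    [s-a]qs≡0 : (s + - a) * qs ≡ 0#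
    [s-a]qs≡0 = begin
      (s + - a) * qs                          ≡⟨ sym (+-identityʳ _) ⟩
      (s + - a) * qs + 0#                     ≡⟨ cong ((s + - a) * qs +_) (sym pa≡0) ⟩
      (s + - a) * qs + evalMonic (c ∷ cs) a   ≡⟨ sym (remainder-theorem a s c cs) ⟩
      evalMonic (c ∷ cs) s                    ≡⟨ ps≡0 ⟩
      0#                                      ∎
  ... | inj₁ s-a≡0 = contradiction (sym (x-y≡0⇒x≡y s-a≡0)) a≢s
  ... | inj₂ qs≡0 = qs≡0

  roots-monic : ∀ cs {rs} → Unique rs → All (λ r → evalMonic cs r ≡ 0#) rs → length rs ≤ length cs
  roots-monic cs {[]} _ _ = z≤n
  roots-monic [] {r ∷ rs} _ (1≡0 ∷ _) = contradiction (sym 1≡0) 0≢1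
  roots-monic (c ∷ cs) {r ∷ rs} (r∉rs ∷ rs-unique) (pr≡0 ∷ prs≡0) =
    s≤s (subst (length rs ≤_) (length-quotientBy r c cs)
      (roots-monic (quotientBy r (c ∷ cs)) rs-unique
        (All.zipWith (λ (r≢s , ps≡0) → root-of-quotientBy c cs pr≡0 ps≡0 r≢s) (r∉rs , prs≡0))))

  roots-pow : ∀ n .{{_ : NonZero n}} b {rs} → Unique rs → All (λ r → r ^ᶠ n ≡ b) rs → length rs ≤ n
  roots-pow (suc n) b {rs} rs-unique rsⁿ≡b =
    subst (length rs ≤_) (cong suc (length-replicate n))
      (roots-monic (- b ∷ replicate n 0#) rs-unique (All.map root rsⁿ≡b))
    where
    evalMonic-replicate : ∀ n x → evalMonic (replicate n 0#) x ≡ x ^ᶠ n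
    evalMonic-replicate zero x = refl
    evalMonic-replicate (suc n) x = trans (+-identityˡ _) (cong (x *_) (evalMonic-replicate n x))
    root : ∀ {r} → r ^ᶠ suc n ≡ b → - b + r * evalMonic (replicate n 0#) r ≡ 0#
    root {r} rⁿ≡b = trans (cong (λ z → - b + r * z) (evalMonic-replicate n r))
                          (trans (cong (- b +_) rⁿ≡b) (-‿inverseˡ b))

  module _ {P : Pred Carrier 0ℓ} (P? : Decidable P) where

    elements : List Carrier
    elements = map (Inverse.from enum) (filter (λ i → P? (Inverse.from enum i)) (allFin size))

    length-elements : length elements ≡ count P?
    length-elements = length-map (Inverse.from enum) (filter (λ i → P? (Inverse.from enum i)) (allFin size))

    elements-unique : Unique elements
    elements-unique = Unique.map⁺ from-injective (Unique.filter⁺ _ (Unique.allFin⁺ size))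
      where
      from-injective : ∀ {i j} → Inverse.from enum i ≡ Inverse.from enum j → i ≡ j
      from-injective {i} {j} eq = trans (sym (Inverse.strictlyInverseˡ enum i))
        (trans (cong (Inverse.to enum) eq) (Inverse.strictlyInverseˡ enum j))

    elements-sound : All P elements
    elements-sound = All.map⁺ (All.all-filter _ (allFin size))

    elements-complete : ∀ {x} → P x → x ∈ elements
    elements-complete {x} px = subst (_∈ elements) (Inverse.strictlyInverseʳ enum x)
      (∈-map⁺ _ (∈-filter⁺ _ (∈-allFin (Inverse.to enum x)) (subst P (sym (Inverse.strictlyInverseʳ enum x)) px)))

    unique⇒length≤count : ∀ {xs} → Unique xs → All P xs → length xs ≤ count P?
    unique⇒length≤count xs-unique all-P = subst (_ ≤_) length-elements
      (unique-⊆⇒length≤ _≟_ xs-unique (λ x∈xs → elements-complete (All.lookup all-P x∈xs)))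

    count≤ : ∀ {n} → (∀ {xs} → Unique xs → All P xs → length xs ≤ n) → count P? ≤ n
    count≤ bound = subst (_≤ _) length-elements (bound elements-unique elements-sound)

  module _ {P Q : Pred Carrier 0ℓ} (P? : Decidable P) (Q? : Decidable Q) where

    count-injective : (f : Carrier → Carrier) → Injective _≡_ _≡_ f → (∀ {x} → P x → Q (f x)) →
      count P? ≤ count Q?
    count-injective f f-injective P⇒Qf = begin
      count P?                        ≡⟨ length-elements P? ⟨
      length (elements P?)            ≡⟨ length-map f (elements P?) ⟨
      length (map f (elements P?))    ≤⟨ unique⇒length≤count Q? (Unique.map⁺ f-injective (elements-unique P?))
                                                                  (All.map⁺ (All.map P⇒Qf (elements-sound P?))) ⟩
      count Q?                        ∎
      where open ℕ.≤-Reasoning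

    count-mono : (∀ {x} → P x → Q x) → count P? ≤ count Q?
    count-mono = count-injective id id

    count-witness : count Q? < count P? → ∃ λ x → P x × ¬ Q x
    count-witness Q<P with any? (∁? Q?) (elements P?)
    ... | yes some = let x , x∈ , ¬Qx = find some in x , All.lookup (elements-sound P?) x∈ , ¬Qx
    ... | no none = contradiction Q<P (ℕ.≤⇒≯ (subst (_≤ count Q?) (length-elements P?)
          (unique⇒length≤count Q? (elements-unique P?)
            (All.tabulate (λ x∈ → decidable-stable (Q? _) (none ∘ lose x∈))))))

    count≤fibres : (f : Carrier → Carrier) (k : ℕ) → (∀ {x} → P x → Q (f x)) →
      (∀ y → count (P? ∩? (λ x → f x ≟ y)) ≤ k) → count P? ≤ k ℕ.* count Q?
    count≤fibres f k P⇒Qf fibres = begin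
      count P?                    ≡⟨ length-elements P? ⟨
      length (elements P?)        ≤⟨ length≤fibres _≟_ f k fibre (elements Q?) (elements-unique P?)
                                       (All.map (λ px → px , elements-complete Q? (P⇒Qf px)) (elements-sound P?)) ⟩
      k ℕ.* length (elements Q?)  ≡⟨ cong (k ℕ.*_) (length-elements Q?) ⟩
      k ℕ.* count Q?              ∎
      where
      open ℕ.≤-Reasoning
      fibre : ∀ y {zs} → Unique zs → All (λ x → P x × f x ≡ y) zs → length zs ≤ k
      fibre y zs-unique zs-over-y =
        ℕ.≤-trans (unique⇒length≤count (P? ∩? (λ x → f x ≟ y)) zs-unique zs-over-y) (fibres y)

  count-without : ∀ {Q : Pred Carrier 0ℓ} (Q? : Decidable Q) {y} → Q y →
    count (Q? ∩? (λ x → ¬? (x ≟ y))) < count Q?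
  count-without Q? {y} Qy = subst (λ n → suc n ≤ count Q?) (length-elements Q-y?)
    (unique⇒length≤count Q? (y∉ ∷ elements-unique Q-y?) (Qy ∷ All.map proj₁ (elements-sound Q-y?)))
    where
    Q-y? = Q? ∩? (λ x → ¬? (x ≟ y))
    y∉ : All (y ≢_) (elements Q-y?)
    y∉ = All.map (λ (_ , x≢y) y≡x → x≢y (sym y≡x)) (elements-sound Q-y?)

  -- If f misses a point of Q, the fibre bound squeezes all of P into fewer than count Q? fibres.
  image-covers : ∀ {P Q : Pred Carrier 0ℓ} (P? : Decidable P) (Q? : Decidable Q)
    (f : Carrier → Carrier) k .{{_ : NonZero k}} →
    (∀ {x} → P x → Q (f x)) → (∀ y → count (P? ∩? (λ x → f x ≟ y)) ≤ k) → k ℕ.* count Q? ≤ count P? →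
    ∀ {y} → Q y → ∃ λ x → P x × f x ≡ y
  image-covers {P} {Q} P? Q? f k P⇒Qf fibres k*Q≤P {y} Qy with any? (λ x → f x ≟ y) (elements P?)
  ... | yes hit = let x , x∈ , fx≡y = find hit in x , All.lookup (elements-sound P?) x∈ , fx≡y
  ... | no miss = contradiction k*Q≤P (ℕ.<⇒≱ (begin-strict
      count P?                                     ≤⟨ count≤fibres P? Q-y? f k P⇒Q-y fibres ⟩
      k ℕ.* count Q-y?                             <⟨ ℕ.*-monoʳ-< k (count-without Q? Qy) ⟩
      k ℕ.* count Q?                               ∎))
    where
    open ℕ.≤-Reasoning
    Q-y? = Q? ∩? (λ x → ¬? (x ≟ y))
    P⇒Q-y : ∀ {x} → P x → Q (f x) × f x ≢ y
    P⇒Q-y px = P⇒Qf px , λ fx≡y → miss (lose (elements-complete P? px) fx≡y)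

  count+count∁ : ∀ {P : Pred Carrier 0ℓ} (P? : Decidable P) → count P? ℕ.+ count (∁? P?) ≡ size
  count+count∁ P? = trans (length-filter+filter∁ (λ i → P? (Inverse.from enum i)) (allFin size))
                          (length-tabulate id)

  count-≡ : ∀ a → count (_≟ a) ≡ 1
  count-≡ a = ℕ.≤-antisym (count≤ (_≟ a) at-most-one) (unique⇒length≤count (_≟ a) ([] ∷ []) (refl ∷ []))
    where
    at-most-one : ∀ {xs} → Unique xs → All (_≡ a) xs → length xs ≤ 1
    at-most-one {[]} _ _ = z≤n
    at-most-one {_ ∷ []} _ _ = s≤s z≤n
    at-most-one {_ ∷ _ ∷ _} ((x≢y ∷ _) ∷ _) (x≡a ∷ y≡a ∷ _) = contradiction (trans x≡a (sym y≡a)) x≢y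

  nonzero? : Decidable (_≢ 0#)
  nonzero? x = ¬? (x ≟ 0#)

  #units : ℕ
  #units = count nonzero?

  size≡1+#units : size ≡ suc #units
  size≡1+#units = trans (sym (count+count∁ (_≟ 0#))) (cong (ℕ._+ #units) (count-≡ 0#))

  #units-nonZero : NonZero #units
  #units-nonZero = ℕ.>-nonZero (unique⇒length≤count nonzero? ([] ∷ []) ((λ 1≡0 → 0≢1 (sym 1≡0)) ∷ []))

  product : List Carrier → Carrier
  product = foldr _*_ 1#

  product-map-* : ∀ x xs → product (map (x *_) xs) ≡ x ^ᶠ length xs * product xs
  product-map-* x [] = sym (*-identityˡ 1#)
  product-map-* x (y ∷ xs) = begin
    x * y * product (map (x *_) xs)         ≡⟨ cong (x * y *_) (product-map-* x xs) ⟩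
    x * y * (x ^ᶠ length xs * product xs)   ≡⟨ solve 4 (λ x y p q → x :* y :* (p :* q) := x :* p :* (y :* q))
                                                       refl x y (x ^ᶠ length xs) (product xs) ⟩
    x * x ^ᶠ length xs * (y * product xs)   ∎
    where open ≡-Reasoning

  product≢0 : ∀ {xs} → All (_≢ 0#) xs → product xs ≢ 0#
  product≢0 [] 1≡0 = 0≢1 (sym 1≡0)
  product≢0 (x≢0 ∷ xs≢0) = *-≢0 x≢0 (product≢0 xs≢0)

  -- Lagrange: multiplication by a unit x permutes the units, so their product u satisfies u = x ^ #units * u.
  pow-#units≡1 : ∀ {x} → x ≢ 0# → x ^ᶠ #units ≡ 1#
  pow-#units≡1 {x} x≢0 = *-cancelˡ (product≢0 (elements-sound nonzero?)) (begin
      u * x ^ᶠ #units             ≡⟨ *-comm u _ ⟩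
      x ^ᶠ #units * u             ≡⟨ cong (λ n → x ^ᶠ n * u) (length-elements nonzero?) ⟨
      x ^ᶠ length units * u       ≡⟨ product-map-* x units ⟨
      product (map (x *_) units)  ≡⟨ foldr-commMonoid *-isCommutativeMonoid (↭⇒↭ₛ x*units↭units) ⟩
      u                           ≡⟨ *-identityʳ u ⟨
      u * 1#                      ∎)
    where
    open ≡-Reasoning
    units = elements nonzero?
    u = product units
    x⁻¹ = proj₁ (inverse x x≢0)
    x⁻¹≢0 : x⁻¹ ≢ 0#
    x⁻¹≢0 x⁻¹≡0 = 0≢1 (trans (sym (zeroʳ x)) (trans (cong (x *_) (sym x⁻¹≡0)) (proj₂ (inverse x x≢0))))
    x*units≈units : ∀ {z} → z ∈ map (x *_) units ⇔ z ∈ units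
    x*units≈units = mk⇔
      (λ z∈ → let y , y∈ , z≡xy = ∈-map⁻ (x *_) z∈ in
        subst (_∈ units) (sym z≡xy) (elements-complete nonzero? (*-≢0 x≢0 (All.lookup (elements-sound nonzero?) y∈))))
      (λ z∈ → subst (_∈ map (x *_) units)
        (trans (sym (*-assoc x x⁻¹ _)) (trans (cong (_* _) (proj₂ (inverse x x≢0))) (*-identityˡ _)))
        (∈-map⁺ (x *_) (elements-complete nonzero? (*-≢0 x⁻¹≢0 (All.lookup (elements-sound nonzero?) z∈)))))
    x*units↭units : map (x *_) units ↭ units
    x*units↭units = ∼bag⇒↭ (unique∧set⇒bag (Unique.map⁺ (*-cancelˡ x≢0) (elements-unique nonzero?))
                                          (elements-unique nonzero?) x*units≈units)

  count-pow≤ : ∀ n .{{_ : NonZero n}} b → count (λ x → x ^ᶠ n ≟ b) ≤ n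
  count-pow≤ n b = count≤ (λ x → x ^ᶠ n ≟ b) (roots-pow n b)

  -- The e-th powers of the units are d-th roots of unity, and each has at most e preimages.
  count-rootsOfUnity : ∀ d .{{_ : NonZero d}} → d ∣ #units → count (λ x → x ^ᶠ d ≟ 1#) ≡ d
  count-rootsOfUnity d d∣#units@(divides e #units≡e*d) =
    ℕ.≤-antisym (count-pow≤ d 1#) (ℕ.*-cancelˡ-≤ e {{e≢0}} (begin
      e ℕ.* d     ≡⟨ #units≡e*d ⟨
      #units      ≤⟨ count≤fibres nonzero? (λ x → x ^ᶠ d ≟ 1#) (_^ᶠ e) e eth-power-is-root fibre ⟩
      e ℕ.* count (λ x → x ^ᶠ d ≟ 1#) ∎))
    where
    open ℕ.≤-Reasoning
    e≢0 = quotient≢0 d∣#units {{#units-nonZero}}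
    eth-power-is-root : ∀ {x} → x ≢ 0# → (x ^ᶠ e) ^ᶠ d ≡ 1#
    eth-power-is-root {x} x≢0 = trans (sym (^ᶠ-* x e d)) (trans (cong (x ^ᶠ_) (sym #units≡e*d)) (pow-#units≡1 x≢0))
    fibre : ∀ y → count (nonzero? ∩? (λ x → x ^ᶠ e ≟ y)) ≤ e
    fibre y = ℕ.≤-trans (count-mono (nonzero? ∩? (λ x → x ^ᶠ e ≟ y)) (λ x → x ^ᶠ e ≟ y) proj₂)
                        (count-pow≤ e {{e≢0}} y)

  count-pow≡ : ∀ d .{{_ : NonZero d}} {r b} → d ∣ #units → r ^ᶠ d ≡ b → b ≢ 0# →
    count (λ x → x ^ᶠ d ≟ b) ≡ d
  count-pow≡ d {r} {b} d∣#units rᵈ≡b b≢0 = ℕ.≤-antisym (count-pow≤ d b)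
    (subst (_≤ count (λ x → x ^ᶠ d ≟ b)) (count-rootsOfUnity d d∣#units)
      (count-injective (λ x → x ^ᶠ d ≟ 1#) (λ x → x ^ᶠ d ≟ b) (r *_) (*-cancelˡ r≢0) shift))
    where
    r≢0 : r ≢ 0#
    r≢0 r≡0 = b≢0 (trans (sym rᵈ≡b) (trans (cong (_^ᶠ d) r≡0) (0^ᶠ d)))
    shift : ∀ {x} → x ^ᶠ d ≡ 1# → (r * x) ^ᶠ d ≡ b
    shift {x} xᵈ≡1 = trans (*-^ᶠ r x d) (trans (cong₂ _*_ rᵈ≡b xᵈ≡1) (*-identityʳ b))

  -- A 2d-th root of unity that is not a d-th root has d-th power a square root of 1 other than 1.
  ∃pow≡-1 : ∀ d .{{_ : NonZero d}} → d ℕ.* 2 ∣ #units → ∃ λ r → r ^ᶠ d ≡ - 1#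
  ∃pow≡-1 d d*2∣#units with count-witness (λ x → x ^ᶠ (d ℕ.* 2) ≟ 1#) (λ x → x ^ᶠ d ≟ 1#) d<d*2
    where
    d<d*2 : count (λ x → x ^ᶠ d ≟ 1#) < count (λ x → x ^ᶠ (d ℕ.* 2) ≟ 1#)
    d<d*2 = subst₂ _<_ (sym (count-rootsOfUnity d (ℕ.m*n∣⇒m∣ d 2 d*2∣#units)))
                       (sym (count-rootsOfUnity (d ℕ.* 2) {{ℕ.m*n≢0 d 2}} d*2∣#units))
                       (ℕ.m<m*n d 2 (s≤s (s≤s z≤n)))
  ... | r , r²ᵈ≡1 , rᵈ≢1 with x*x≡1⇒sign (r ^ᶠ d) (trans (cong (r ^ᶠ d *_) (sym (*-identityʳ _)))
                                                 (trans (sym (^ᶠ-* r d 2)) r²ᵈ≡1))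
  ... | inj₁ rᵈ≡1 = contradiction rᵈ≡1 rᵈ≢1
  ... | inj₂ rᵈ≡-1 = r , rᵈ≡-1

  count-pow≡sign : ∀ d .{{_ : NonZero d}} {ε} → d ℕ.* 2 ∣ #units → IsSign ε →
    count (λ x → x ^ᶠ d ≟ ε) ≡ d
  count-pow≡sign d d*2∣#units (inj₁ refl) = count-rootsOfUnity d (ℕ.m*n∣⇒m∣ d 2 d*2∣#units)
  count-pow≡sign d d*2∣#units (inj₂ refl) =
    count-pow≡ d (ℕ.m*n∣⇒m∣ d 2 d*2∣#units) (proj₂ (∃pow≡-1 d d*2∣#units)) -1≢0

  InW⇒pow≡-1 : ∀ A {w} → InW (suc A) w → w ≢ 0# → w ^ᶠ A ≡ - 1#
  InW⇒pow≡-1 A {w} w∈W w≢0 with x*y≡0⇒x≡0⊎y≡0 w (w ^ᶠ A + 1#)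
                                  (trans (distribˡ w _ 1#) (trans (cong (w * w ^ᶠ A +_) (*-identityʳ w)) w∈W))
  ... | inj₁ w≡0 = contradiction w≡0 w≢0
  ... | inj₂ wᴬ+1≡0 = +-inverseˡ-unique _ _ wᴬ+1≡0

  pow≡-1⇒InW : ∀ A {w} → w ^ᶠ A ≡ - 1# → InW (suc A) w
  pow≡-1⇒InW A {w} wᴬ≡-1 = begin
    w * w ^ᶠ A + w          ≡⟨ cong₂ (λ a b → w * a + b) wᴬ≡-1 (sym (*-identityʳ w)) ⟩
    w * - 1# + w * 1#       ≡⟨ distribˡ w (- 1#) 1# ⟨
    w * (- 1# + 1#)         ≡⟨ cong (w *_) (-‿inverseˡ 1#) ⟩
    w * 0#                  ≡⟨ zeroʳ w ⟩
    0#                      ∎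
    where open ≡-Reasoning

  pow≡sign⇒pow≡1 : ∀ {x ε} D {A} → IsSign ε → D ℕ.* 2 ∣ A → x ^ᶠ D ≡ ε → x ^ᶠ A ≡ 1#
  pow≡sign⇒pow≡1 {x} {ε} D {A} sign-ε (divides c A≡c*[D*2]) xᴰ≡ε = begin
    x ^ᶠ A                       ≡⟨ cong (x ^ᶠ_) (trans A≡c*[D*2] (ℕ.*-comm c _)) ⟩
    x ^ᶠ (D ℕ.* 2 ℕ.* c)         ≡⟨ ^ᶠ-* x (D ℕ.* 2) c ⟩
    (x ^ᶠ (D ℕ.* 2)) ^ᶠ c        ≡⟨ cong (_^ᶠ c) (^ᶠ-* x D 2) ⟩
    ((x ^ᶠ D) ^ᶠ 2) ^ᶠ c         ≡⟨ cong (λ y → (y ^ᶠ 2) ^ᶠ c) xᴰ≡ε ⟩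
    (ε * (ε * 1#)) ^ᶠ c          ≡⟨ cong (λ y → (ε * y) ^ᶠ c) (*-identityʳ ε) ⟩
    (ε * ε) ^ᶠ c                 ≡⟨ cong (_^ᶠ c) (sign*sign≡1 sign-ε) ⟩
    1# ^ᶠ c                      ≡⟨ 1^ᶠ c ⟩
    1#                           ∎
    where open ≡-Reasoning

  #units≡A*[2+A] : ∀ A → size ≡ suc A ℕ.* suc A → #units ≡ A ℕ.* (2 ℕ.+ A)
  #units≡A*[2+A] A size≡[1+A]² =
    trans (ℕ.suc-injective (trans (sym size≡1+#units) size≡[1+A]²)) (sym (ℕ.*-suc A (suc A)))

  count-W∖0 : ∀ A .{{_ : NonZero A}} → size ≡ suc A ℕ.* suc A → 2 ∣ A → count (λ w → w ^ᶠ A ≟ - 1#) ≡ A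
  count-W∖0 A size≡[1+A]² 2∣A = count-pow≡sign A
    (subst (A ℕ.* 2 ∣_) (sym (#units≡A*[2+A] A size≡[1+A]²)) (ℕ.*-monoʳ-∣ A (ℕ.∣m∣n⇒∣m+n ℕ.∣-refl 2∣A)))
    (inj₂ refl)

  powers-of-W : ∀ Q s D k {ε} .{{_ : NonZero s}} → 1 < Q → size ≡ Q ℕ.* Q →
    D ℕ.* k ≡ Q ∸ 1 → D ℕ.* 2 ∣ Q ∸ 1 → IsSign ε →
    (∀ {w} → w ^ᶠ (Q ∸ 1) ≡ - 1# → (w ^ᶠ s) ^ᶠ D ≡ ε) →
    (∀ y → count ((λ w → w ^ᶠ (Q ∸ 1) ≟ - 1#) ∩? (λ w → w ^ᶠ s ≟ y)) ≤ k) →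
    (∀ x → (InSubStar Q x × PowOfW Q s x) ⇔ (x ^ᶠ D ≡ ε)) × count (λ x → x ^ᶠ D ≟ ε) ≡ D
  powers-of-W (suc A) s D k {ε} (s≤s 1≤A) size≡Q² D*k≡A D*2∣A sign-ε maps-into fibres =
      (λ x → mk⇔ into onto) , count-T
    where
    S? = λ w → w ^ᶠ A ≟ - 1#
    T? = λ x → x ^ᶠ D ≟ ε
    A≢0 : NonZero A
    A≢0 = ℕ.>-nonZero 1≤A
    D*k≢0 : NonZero (D ℕ.* k)
    D*k≢0 = subst NonZero (sym D*k≡A) A≢0
    instance
      D≢0 : NonZero D
      D≢0 = ℕ.m*n≢0⇒m≢0 D {{D*k≢0}}
      k≢0 : NonZero k
      k≢0 = ℕ.m*n≢0⇒n≢0 D {{D*k≢0}}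
    count-S : count S? ≡ A
    count-S = count-W∖0 A {{A≢0}} size≡Q² (ℕ.m*n∣⇒n∣ D 2 D*2∣A)
    count-T : count T? ≡ D
    count-T = count-pow≡sign D
      (subst (D ℕ.* 2 ∣_) (sym (#units≡A*[2+A] A size≡Q²)) (ℕ.∣m⇒∣m*n (2 ℕ.+ A) D*2∣A)) sign-ε
    into : ∀ {x} → InSubStar (suc A) x × PowOfW (suc A) s x → x ^ᶠ D ≡ ε
    into {x} ((_ , x≢0) , w , w∈W , wˢ≡x) = trans (cong (_^ᶠ D) (sym wˢ≡x)) (maps-into (InW⇒pow≡-1 A w∈W w≢0))
      where
      w≢0 : w ≢ 0#
      w≢0 w≡0 = x≢0 (trans (sym wˢ≡x) (trans (cong (_^ᶠ s) w≡0) (0^ᶠ s)))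
    onto : ∀ {x} → x ^ᶠ D ≡ ε → InSubStar (suc A) x × PowOfW (suc A) s x
    onto {x} xᴰ≡ε = (trans (cong (x *_) (pow≡sign⇒pow≡1 D sign-ε D*2∣A xᴰ≡ε)) (*-identityʳ x) , x≢0)
                  , w , pow≡-1⇒InW A wᴬ≡-1 , wˢ≡x
      where
      x≢0 : x ≢ 0#
      x≢0 x≡0 = sign≢0 sign-ε (trans (sym xᴰ≡ε) (trans (cong (_^ᶠ D) x≡0) (0^ᶠ D)))
      k*T≤S : k ℕ.* count T? ≤ count S?
      k*T≤S = ℕ.≤-reflexive (trans (cong (k ℕ.*_) count-T) (trans (ℕ.*-comm k D) (trans D*k≡A (sym count-S))))
      preimage = image-covers S? T? (_^ᶠ s) k maps-into fibres k*T≤S xᴰ≡ε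
      w = proj₁ preimage
      wᴬ≡-1 = proj₁ (proj₂ preimage)
      wˢ≡x = proj₂ (proj₂ preimage)

  powers-of-W-dividing : ∀ Q s .{{_ : NonZero s}} → 1 < Q → size ≡ Q ℕ.* Q → s ∣ Q ∸ 1 → 2 ∣ s →
    (∀ x → (InSubStar Q x × PowOfW Q s x) ⇔ (x ^ᶠ div (Q ∸ 1) s ≡ - 1#))
    × count (λ x → x ^ᶠ div (Q ∸ 1) s ≟ - 1#) ≡ div (Q ∸ 1) s
  powers-of-W-dividing Q s 1<Q size≡Q² s∣A 2∣s =
    powers-of-W Q s D s 1<Q size≡Q² (div*n≡m s s∣A) (subst (D ℕ.* 2 ∣_) (div*n≡m s s∣A) (ℕ.*-monoʳ-∣ D 2∣s))
      (inj₂ refl) maps-into fibres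
    where
    D = div (Q ∸ 1) s
    maps-into : ∀ {w} → w ^ᶠ (Q ∸ 1) ≡ - 1# → (w ^ᶠ s) ^ᶠ D ≡ - 1#
    maps-into {w} wᴬ≡-1 =
      trans (sym (^ᶠ-* w s D)) (trans (cong (w ^ᶠ_) (trans (ℕ.*-comm s D) (div*n≡m s s∣A))) wᴬ≡-1)
    fibres : ∀ y → count ((λ w → w ^ᶠ (Q ∸ 1) ≟ - 1#) ∩? (λ w → w ^ᶠ s ≟ y)) ≤ s
    fibres y = ℕ.≤-trans
      (count-mono ((λ w → w ^ᶠ (Q ∸ 1) ≟ - 1#) ∩? (λ w → w ^ᶠ s ≟ y)) (λ w → w ^ᶠ s ≟ y) proj₂)
      (count-pow≤ s y)

  -- On W the fibre of w ↦ w ^ s over y lies in {w² = -y ^ j}, where s j = Q + 1, because w ^ (Q + 1) = - w².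
  powers-of-W-odd : ∀ Q s .{{_ : NonZero s}} → 1 < Q → size ≡ Q ℕ.* Q → 2 ∣ Q ∸ 1 → s ∣ Q ℕ.+ 1 → 2 ∣ s →
    (∀ x → (InSubStar Q x × PowOfW Q s x) ⇔ (x ^ᶠ div (Q ∸ 1) 2 ≡ (- 1#) ^ᶠ div s 2))
    × count (λ x → x ^ᶠ div (Q ∸ 1) 2 ≟ (- 1#) ^ᶠ div s 2) ≡ div (Q ∸ 1) 2
  powers-of-W-odd (suc A) s 1<Q size≡Q² 2∣A s∣Q+1 2∣s =
    powers-of-W (suc A) s D 2 1<Q size≡Q² (div*n≡m 2 2∣A) (ℕ.∣-reflexive (div*n≡m {A} 2 2∣A))
      (-1^ᶠ-sign u) maps-into fibres
    where
    D = div A 2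
    u = div s 2
    j = div (suc A ℕ.+ 1) s
    maps-into : ∀ {w} → w ^ᶠ A ≡ - 1# → (w ^ᶠ s) ^ᶠ D ≡ (- 1#) ^ᶠ u
    maps-into {w} wᴬ≡-1 = begin
      (w ^ᶠ s) ^ᶠ D          ≡⟨ ^ᶠ-* w s D ⟨
      w ^ᶠ (s ℕ.* D)         ≡⟨ cong (w ^ᶠ_) s*D≡A*u ⟩
      w ^ᶠ (A ℕ.* u)         ≡⟨ ^ᶠ-* w A u ⟩
      (w ^ᶠ A) ^ᶠ u          ≡⟨ cong (_^ᶠ u) wᴬ≡-1 ⟩
      (- 1#) ^ᶠ u            ∎
      where
      open ≡-Reasoning
      s*D≡A*u : s ℕ.* D ≡ A ℕ.* u
      s*D≡A*u = begin
        s ℕ.* D             ≡⟨ cong (ℕ._* D) (div*n≡m 2 2∣s) ⟨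
        u ℕ.* 2 ℕ.* D       ≡⟨ ℕ.*-assoc u 2 D ⟩
        u ℕ.* (2 ℕ.* D)     ≡⟨ cong (u ℕ.*_) (trans (ℕ.*-comm 2 D) (div*n≡m 2 2∣A)) ⟩
        u ℕ.* A             ≡⟨ ℕ.*-comm u A ⟩
        A ℕ.* u             ∎
    w²≡-yʲ : ∀ {y w} → w ^ᶠ A ≡ - 1# × w ^ᶠ s ≡ y → w ^ᶠ 2 ≡ - (y ^ᶠ j)
    w²≡-yʲ {y} {w} (wᴬ≡-1 , wˢ≡y) = trans (sym (-‿involutive _)) (cong -_ (begin
      - (w ^ᶠ 2)             ≡⟨ -1*x≈-x _ ⟨
      - 1# * w ^ᶠ 2          ≡⟨ cong (_* w ^ᶠ 2) wᴬ≡-1 ⟨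
      w ^ᶠ A * w ^ᶠ 2        ≡⟨ ^ᶠ-+ w A 2 ⟨
      w ^ᶠ (A ℕ.+ 2)         ≡⟨ cong (w ^ᶠ_) (trans (ℕ.+-suc A 1) (sym (div*n≡m s s∣Q+1))) ⟩
      w ^ᶠ (j ℕ.* s)         ≡⟨ cong (w ^ᶠ_) (ℕ.*-comm j s) ⟩
      w ^ᶠ (s ℕ.* j)         ≡⟨ ^ᶠ-* w s j ⟩
      (w ^ᶠ s) ^ᶠ j          ≡⟨ cong (_^ᶠ j) wˢ≡y ⟩
      y ^ᶠ j                 ∎))
      where open ≡-Reasoning
    fibres : ∀ y → count ((λ w → w ^ᶠ A ≟ - 1#) ∩? (λ w → w ^ᶠ s ≟ y)) ≤ 2
    fibres y = ℕ.≤-trans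
      (count-mono ((λ w → w ^ᶠ A ≟ - 1#) ∩? (λ w → w ^ᶠ s ≟ y)) (λ w → w ^ᶠ 2 ≟ - (y ^ᶠ j)) w²≡-yʲ)
      (count-pow≤ 2 (- (y ^ᶠ j)))

proposition2p5 : (q t : ℕ) → IsPrimePower q → ¬ (2 ∣ q) → 3 ≤ t →
    (F : FiniteField) → FiniteField.size F ≡ q ^ (2 ℕ.* t) →
    let open FiniteField F in
    ((∀ x → (InSubStar (q ^ t) x × PowOfW (q ^ t) (q ∸ 1) x)
              ⇔ (x ^ᶠ div (q ^ t ∸ 1) (q ∸ 1) ≡ - 1#))
      × count (λ x → x ^ᶠ div (q ^ t ∸ 1) (q ∸ 1) ≟ - 1#) ≡ div (q ^ t ∸ 1) (q ∸ 1))
    × (2 ∣ t →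
        (∀ x → (InSubStar (q ^ t) x × PowOfW (q ^ t) (q ℕ.+ 1) x)
                ⇔ (x ^ᶠ div (q ^ t ∸ 1) (q ℕ.+ 1) ≡ - 1#))
        × count (λ x → x ^ᶠ div (q ^ t ∸ 1) (q ℕ.+ 1) ≟ - 1#) ≡ div (q ^ t ∸ 1) (q ℕ.+ 1))
    × (¬ (2 ∣ t) →
        (∀ x → (InSubStar (q ^ t) x × PowOfW (q ^ t) (q ℕ.+ 1) x)
                ⇔ (x ^ᶠ div (q ^ t ∸ 1) 2 ≡ (- 1#) ^ᶠ div (q ℕ.+ 1) 2))
        × count (λ x → x ^ᶠ div (q ^ t ∸ 1) 2 ≟ (- 1#) ^ᶠ div (q ℕ.+ 1) 2) ≡ div (q ^ t ∸ 1) 2)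
proposition2p5 q t q-prime-power 2∤q 3≤t F size≡q^2t =
    powers-of-W-dividing F (q ^ t) (q ∸ 1) 1<q^t size≡q^t*q^t (∣m∸1⇒∣m^n∸1 q t ℕ.∣-refl) (odd⇒2∣m∸1 2∤q)
  , (λ 2∣t → powers-of-W-dividing F (q ^ t) (q ℕ.+ 1) 1<q^t size≡q^t*q^t
               (even⇒m+1∣m^t∸1 q 2∣t) (odd⇒2∣m+1 2∤q))
  , (λ 2∤t → powers-of-W-odd F (q ^ t) (q ℕ.+ 1) 1<q^t size≡q^t*q^t
               (∣m∸1⇒∣m^n∸1 q t (odd⇒2∣m∸1 2∤q)) (odd⇒m+1∣m^t+1 q 2∤t) (odd⇒2∣m+1 2∤q))
  where
  1<q : 1 < q
  1<q = prime-power⇒1< q-prime-power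
  instance
    q≢0 : NonZero q
    q≢0 = ℕ.>-nonZero (ℕ.<⇒≤ 1<q)
    q∸1≢0 : NonZero (q ∸ 1)
    q∸1≢0 = ℕ.>-nonZero (ℕ.m<n⇒0<n∸m 1<q)
    q+1≢0 : NonZero (q ℕ.+ 1)
    q+1≢0 = ℕ.>-nonZero (ℕ.m≤n+m 1 q)
  1<q^t : 1 < q ^ t
  1<q^t = ℕ.^-monoʳ-< q 1<q (ℕ.≤-trans (s≤s z≤n) 3≤t)
  size≡q^t*q^t : FiniteField.size F ≡ q ^ t ℕ.* q ^ t
  size≡q^t*q^t = trans size≡q^2t (trans (cong (λ n → q ^ (t ℕ.+ n)) (ℕ.+-identityʳ t)) (ℕ.^-distribˡ-+-* q t t))
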